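{- Let $\pi\in I(321)$ be of type $21$. Then there is $m\geq 1$ such that $$\pi=21[12\cdots m,\;12\cdots m]=(m+1)(m+2)\cdots(2m)\,1\,2\cdots m,$$ so in particular $\pi$ has even length $2m$, i.e. $\pi\in I(321)_{2m}$.
   Context: A permutation of length $n$ is a bijection of $\{1,\dots,n\}$ in one-line notation. A permutation avoids $321$ if it has no indices $i<j<k$ with $\pi(i)>\pi(j)>\pi(k)$. An involution satisfies $\pi(\pi(i))=i$ for all $i$. $I(321)$ is the set of involutions avoiding $321$ and $I(321)_n$ those of length $n$. For nonempty permutations $\alpha_1$ of length $a$ and $\alpha_2$ of length $b$, $21[\alpha_1,\alpha_2]$ is the permutation of length $a+b$ whose first $a$ entries are $b+\alpha_1(1),\dots,b+\alpha_1(a)$ and whose last $b$ entries are $\alpha_2(1),\dots,\alpha_2(b)$. A permutation is of type $21$ if it equals $21[\alpha_1,\alpha_2]$ for some nonempty $\alpha_1,\alpha_2$. $12\cdots m$ denotes the identity permutation of length $m$. -}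

module Defs where

open import Data.Nat using (ℕ; _+_; _∸_; _<_; _≥_; _<?_)
open import Data.Fin using (Fin; toℕ; splitAt; cast)
open import Data.Fin.Permutation using (Permutation′; _⟨$⟩ʳ_; id)
open import Data.Product using (Σ; ∃; ∃-syntax; _×_)
open import Data.Sum using (inj₁; inj₂)
open import Relation.Binary.PropositionalEquality using (_≡_)
open import Relation.Nullary using (¬_; yes; no)

-- Permutations of length n: bijections of Fin n = {0,…,n-1} (0-indexed
-- version of {1,…,n}); one-line notation i ↦ π ⟨$⟩ʳ i.
Perm : ℕ → Set
Perm n = Permutation′ n

Contains321 : ∀ {n} → Perm n → Set
Contains321 {n} π = ∃[ i ] ∃[ j ] ∃[ k ]
  (i Data.Fin.< j × j Data.Fin.< k ×
   (π ⟨$⟩ʳ j) Data.Fin.< (π ⟨$⟩ʳ i) × (π ⟨$⟩ʳ k) Data.Fin.< (π ⟨$⟩ʳ j))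

Avoids321 : ∀ {n} → Perm n → Set
Avoids321 π = ¬ Contains321 π

IsInvolution : ∀ {n} → Perm n → Set
IsInvolution {n} π = (i : Fin n) → π ⟨$⟩ʳ (π ⟨$⟩ʳ i) ≡ i

InI321 : ∀ {n} → Perm n → Set
InI321 π = IsInvolution π × Avoids321 π

-- one-line values (as naturals, 0-indexed) of 21[α₁,α₂] of length a+b:
-- first a entries are b + α₁(i), last b entries are α₂(j).
inflate21 : ∀ a b → Perm a → Perm b → Fin (a + b) → ℕ
inflate21 a b α₁ α₂ i with splitAt a i
... | inj₁ x = b + toℕ (α₁ ⟨$⟩ʳ x)
... | inj₂ y = toℕ (α₂ ⟨$⟩ʳ y)

Is21Inflation : ∀ {n} a b → a + b ≡ n → Perm n → Perm a → Perm b → Set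
Is21Inflation a b e π α₁ α₂ =
  (i : Fin (a + b)) → toℕ (π ⟨$⟩ʳ cast e i) ≡ inflate21 a b α₁ α₂ i

IsType21 : ∀ {n} → Perm n → Set
IsType21 {n} π = Σ ℕ λ a → Σ ℕ λ b → Σ (a + b ≡ n) λ e →
  a ≥ 1 × b ≥ 1 × Σ (Perm a) λ α₁ → Σ (Perm b) λ α₂ →
  Is21Inflation a b e π α₁ α₂

-- the permutation (m+1)(m+2)…(2m) 1 2 … m, in 0-indexed values:
-- position i < m ↦ m + i, position i ≥ m ↦ i − m.
standard21 : ℕ → ℕ → ℕ
standard21 m i with i <? m
... | yes _ = m + i
... | no _ = i ∸ m

idPerm : ∀ m → Perm m
idPerm m = id

module Submission where

-- A strictly increasing self-map of Fin m never
--    moves a point down; applied to σ and σ⁻¹ this shows that a strictly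
--    increasing permutation is the identity.
-- 2. The block swap  k ↦ b + k (k < a),  k ↦ k − a (k ≥ a), which lists the
--    values of 21[12⋯a, 12⋯b].  If an involution acts as this map then
--    applying it twice to position 0 forces a = b.
-- 3. 321-avoiding inflations.  Every value of the left block of 21[α₁, α₂]
--    exceeds every value of the right block, so an inversion inside one block
--    together with any entry of the other block is a 321 pattern.  Hence both
--    α₁ and α₂ are increasing, thus identities, and π is the block swap.

open import Defs
open import Data.Nat using (ℕ; zero; suc; _+_; _∸_; _≤_; _<_; _≥_; z≤n; s≤s; _<?_)
open import Data.Nat.Properties
open import Data.Fin using (Fin; toℕ; cast; _↑ˡ_; _↑ʳ_; splitAt; fromℕ<)
open import Data.Fin.Properties
  using (toℕ<n; toℕ-injective; toℕ-cast; toℕ-↑ˡ; toℕ-↑ʳ; toℕ-fromℕ<;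
         splitAt-↑ˡ; splitAt-↑ʳ; splitAt⁻¹-↑ˡ; splitAt⁻¹-↑ʳ; cast-involutive)
open import Data.Fin.Permutation using (_⟨$⟩ʳ_; _⟨$⟩ˡ_; flip; inverseˡ; inverseʳ)
open import Data.Product using (Σ; _×_; _,_)
open import Data.Sum using (inj₁; inj₂)
open import Relation.Binary.PropositionalEquality
open import Relation.Binary.Definitions using (tri<; tri≈; tri>)
open import Relation.Nullary using (¬_; yes; no)
open import Data.Empty using (⊥-elim)

Increasing : ∀ {m} → (Fin m → Fin m) → Set
Increasing {m} f = ∀ (x y : Fin m) → toℕ x < toℕ y → toℕ (f x) < toℕ (f y)

IsIdentity : ∀ {m} → Perm m → Set
IsIdentity {m} σ = ∀ (x : Fin m) → toℕ (σ ⟨$⟩ʳ x) ≡ toℕ x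

-- A strictly increasing self-map of Fin m satisfies x ≤ f x: the points
-- below x are sent injectively and in order below f x.
increasing⇒inflationary : ∀ {m} (f : Fin m → Fin m) → Increasing f →
  ∀ x → toℕ x ≤ toℕ (f x)
increasing⇒inflationary {m} f inc x = below (toℕ x) x ≤-refl
  where
  below : ∀ k (x : Fin m) → k ≤ toℕ x → k ≤ toℕ (f x)
  below zero    x _   = z≤n
  below (suc k) x k<x = ≤-trans (s≤s (below k x′ (≤-reflexive (sym x′≡k)))) (inc x′ x x′<x)
    where
    k<m : k < m
    k<m = <-trans k<x (toℕ<n x)
    x′ : Fin m
    x′ = fromℕ< k<m
    x′≡k : toℕ x′ ≡ k
    x′≡k = toℕ-fromℕ< k<m
    x′<x : toℕ x′ < toℕ x
    x′<x = subst (_< toℕ x) (sym x′≡k) k<x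

⟨$⟩ʳ-injective : ∀ {m} (σ : Perm m) {x y} → toℕ (σ ⟨$⟩ʳ x) ≡ toℕ (σ ⟨$⟩ʳ y) → x ≡ y
⟨$⟩ʳ-injective σ {x} {y} eq = begin
  x                    ≡⟨ sym (inverseˡ σ) ⟩
  σ ⟨$⟩ˡ (σ ⟨$⟩ʳ x)    ≡⟨ cong (σ ⟨$⟩ˡ_) (toℕ-injective eq) ⟩
  σ ⟨$⟩ˡ (σ ⟨$⟩ʳ y)    ≡⟨ inverseˡ σ ⟩
  y                    ∎
  where open ≡-Reasoning

no-inversion⇒increasing : ∀ {m} (σ : Perm m) →
  (∀ x y → toℕ x < toℕ y → ¬ toℕ (σ ⟨$⟩ʳ y) < toℕ (σ ⟨$⟩ʳ x)) →
  Increasing (σ ⟨$⟩ʳ_)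
no-inversion⇒increasing σ none x y x<y with <-cmp (toℕ (σ ⟨$⟩ʳ x)) (toℕ (σ ⟨$⟩ʳ y))
... | tri< p _ _ = p
... | tri≈ _ p _ = ⊥-elim (<-irrefl (cong toℕ (⟨$⟩ʳ-injective σ p)) x<y)
... | tri> _ _ p = ⊥-elim (none x y x<y p)

increasing-inverse : ∀ {m} (σ : Perm m) → Increasing (σ ⟨$⟩ʳ_) → Increasing (σ ⟨$⟩ˡ_)
increasing-inverse σ inc = no-inversion⇒increasing (flip σ) inverted
  where
  inverted : ∀ y y′ → toℕ y < toℕ y′ → ¬ toℕ (σ ⟨$⟩ˡ y′) < toℕ (σ ⟨$⟩ˡ y)
  inverted y y′ y<y′ p =
    <-asym y<y′ (subst₂ (λ u v → toℕ u < toℕ v) (inverseʳ σ) (inverseʳ σ) (inc _ _ p))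

-- an increasing permutation is the identity: x ≤ σ x and x = σ⁻¹(σ x) ≥ σ x
increasing⇒identity : ∀ {m} (σ : Perm m) → Increasing (σ ⟨$⟩ʳ_) → IsIdentity σ
increasing⇒identity σ inc x = ≤-antisym σx≤x (increasing⇒inflationary _ inc x)
  where
  σx≤x : toℕ (σ ⟨$⟩ʳ x) ≤ toℕ x
  σx≤x = subst (λ u → toℕ (σ ⟨$⟩ʳ x) ≤ toℕ u) (inverseˡ σ)
           (increasing⇒inflationary _ (increasing-inverse σ inc) (σ ⟨$⟩ʳ x))

-- value at position k of 21[12⋯a, 12⋯b] (0-indexed)
blockSwap : ℕ → ℕ → ℕ → ℕ
blockSwap a b k with k <? a
... | yes _ = b + k
... | no _  = k ∸ a

blockSwap-low : ∀ {a} b {k} → k < a → blockSwap a b k ≡ b + k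
blockSwap-low {a} b {k} k<a with k <? a
... | yes _  = refl
... | no k≮a = ⊥-elim (k≮a k<a)

blockSwap-high : ∀ a b k → blockSwap a b (a + k) ≡ k
blockSwap-high a b k with a + k <? a
... | yes a+k<a = ⊥-elim (m+n≮m a k a+k<a)
... | no _      = m+n∸m≡n a k

blockSwap-standard21 : ∀ m k → blockSwap m m k ≡ standard21 m k
blockSwap-standard21 m k with k <? m
... | yes _ = refl
... | no _  = refl

inflate21-identityBlocks : ∀ a b (α₁ : Perm a) (α₂ : Perm b) →
  IsIdentity α₁ → IsIdentity α₂ →
  ∀ i → inflate21 a b α₁ α₂ i ≡ blockSwap a b (toℕ i)
inflate21-identityBlocks a b α₁ α₂ id₁ id₂ i with splitAt a i in split
... | inj₁ x = begin
  b + toℕ (α₁ ⟨$⟩ʳ x)     ≡⟨ cong (b +_) (id₁ x) ⟩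
  b + toℕ x               ≡⟨ sym (blockSwap-low b (toℕ<n x)) ⟩
  blockSwap a b (toℕ x)   ≡⟨ cong (blockSwap a b) (sym (toℕ-↑ˡ x b)) ⟩
  blockSwap a b (toℕ (x ↑ˡ b)) ≡⟨ cong (λ j → blockSwap a b (toℕ j)) (splitAt⁻¹-↑ˡ split) ⟩
  blockSwap a b (toℕ i)   ∎
  where open ≡-Reasoning
... | inj₂ y = begin
  toℕ (α₂ ⟨$⟩ʳ y)          ≡⟨ id₂ y ⟩
  toℕ y                    ≡⟨ sym (blockSwap-high a b (toℕ y)) ⟩
  blockSwap a b (a + toℕ y) ≡⟨ cong (blockSwap a b) (sym (toℕ-↑ʳ a y)) ⟩
  blockSwap a b (toℕ (a ↑ʳ y)) ≡⟨ cong (λ j → blockSwap a b (toℕ j)) (splitAt⁻¹-↑ʳ split) ⟩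
  blockSwap a b (toℕ i)    ∎
  where open ≡-Reasoning

ActsAsBlockSwap : ∀ {n} → Perm n → ℕ → ℕ → Set
ActsAsBlockSwap {n} π a b = ∀ (q : Fin n) → toℕ (π ⟨$⟩ʳ q) ≡ blockSwap a b (toℕ q)

blockSwap-involutive : ∀ {n} (π : Perm n) a b → IsInvolution π →
  ActsAsBlockSwap π a b → ∀ k → k < n → blockSwap a b (blockSwap a b k) ≡ k
blockSwap-involutive π a b inv swap k k<n = begin
  blockSwap a b (blockSwap a b k)       ≡⟨ cong (λ j → blockSwap a b (blockSwap a b j)) (sym q≡k) ⟩
  blockSwap a b (blockSwap a b (toℕ q)) ≡⟨ cong (blockSwap a b) (sym (swap q)) ⟩
  blockSwap a b (toℕ (π ⟨$⟩ʳ q))        ≡⟨ sym (swap (π ⟨$⟩ʳ q)) ⟩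
  toℕ (π ⟨$⟩ʳ (π ⟨$⟩ʳ q))               ≡⟨ cong toℕ (inv q) ⟩
  toℕ q                                 ≡⟨ q≡k ⟩
  k                                     ∎
  where
  open ≡-Reasoning
  q : Fin _
  q = fromℕ< k<n
  q≡k : toℕ q ≡ k
  q≡k = toℕ-fromℕ< k<n

-- the block swap sends 0 to b and b back to 0 only when the blocks are equal:
-- for b < a the value at b is b + b ≠ 0, for b ≥ a it is b − a
blockSwap-balanced : ∀ {a b} → a ≥ 1 → b ≥ 1 →
  blockSwap a b (blockSwap a b 0) ≡ 0 → a ≡ b
blockSwap-balanced {a} {b} a≥1 b≥1 round-trip =
  returns (subst (λ k → blockSwap a b k ≡ 0) (trans (blockSwap-low b a≥1) (+-identityʳ b)) round-trip)
  where
  returns : blockSwap a b b ≡ 0 → a ≡ b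
  returns eq with b <? a
  ... | yes _  = ⊥-elim (<-irrefl (sym eq) (<-≤-trans b≥1 (m≤m+n b b)))
  ... | no b≮a = ≤-antisym (≮⇒≥ b≮a) (m∸n≡0⇒m≤n eq)

module Inflation21 {n : ℕ} (π : Perm n) {a b : ℕ} (e : a + b ≡ n)
                   {α₁ : Perm a} {α₂ : Perm b} (π≡21 : Is21Inflation a b e π α₁ α₂) where

  left : Fin a → Fin n
  left x = cast e (x ↑ˡ b)

  right : Fin b → Fin n
  right y = cast e (a ↑ʳ y)

  left-pos : ∀ x → toℕ (left x) ≡ toℕ x
  left-pos x = trans (toℕ-cast e (x ↑ˡ b)) (toℕ-↑ˡ x b)

  right-pos : ∀ y → toℕ (right y) ≡ a + toℕ y
  right-pos y = trans (toℕ-cast e (a ↑ʳ y)) (toℕ-↑ʳ a y)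

  left-val : ∀ x → toℕ (π ⟨$⟩ʳ left x) ≡ b + toℕ (α₁ ⟨$⟩ʳ x)
  left-val x rewrite π≡21 (x ↑ˡ b) | splitAt-↑ˡ a x b = refl

  right-val : ∀ y → toℕ (π ⟨$⟩ʳ right y) ≡ toℕ (α₂ ⟨$⟩ʳ y)
  right-val y rewrite π≡21 (a ↑ʳ y) | splitAt-↑ʳ a b y = refl

  left-before-right : ∀ x y → toℕ (left x) < toℕ (right y)
  left-before-right x y = subst₂ _<_ (sym (left-pos x)) (sym (right-pos y))
    (<-≤-trans (toℕ<n x) (m≤m+n a (toℕ y)))

  right-below-left : ∀ x y → toℕ (π ⟨$⟩ʳ right y) < toℕ (π ⟨$⟩ʳ left x)
  right-below-left x y = subst₂ _<_ (sym (right-val y)) (sym (left-val x))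
    (<-≤-trans (toℕ<n (α₂ ⟨$⟩ʳ y)) (m≤m+n b _))

  identityBlocks⇒blockSwap : IsIdentity α₁ → IsIdentity α₂ → ActsAsBlockSwap π a b
  identityBlocks⇒blockSwap id₁ id₂ q = begin
    toℕ (π ⟨$⟩ʳ q)                      ≡⟨ cong (λ j → toℕ (π ⟨$⟩ʳ j)) (sym (cast-involutive e (sym e) q)) ⟩
    toℕ (π ⟨$⟩ʳ cast e (cast (sym e) q)) ≡⟨ π≡21 (cast (sym e) q) ⟩
    inflate21 a b α₁ α₂ (cast (sym e) q) ≡⟨ inflate21-identityBlocks a b α₁ α₂ id₁ id₂ _ ⟩
    blockSwap a b (toℕ (cast (sym e) q)) ≡⟨ cong (blockSwap a b) (toℕ-cast (sym e) q) ⟩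
    blockSwap a b (toℕ q)                ∎
    where open ≡-Reasoning

  -- An inversion inside one block, together with any entry of the other
  -- block, is a 321 pattern; so when π avoids 321 both blocks are increasing.
  module Avoiding (avoids : Avoids321 π) (a≥1 : a ≥ 1) (b≥1 : b ≥ 1) where

    α₁-increasing : Increasing (α₁ ⟨$⟩ʳ_)
    α₁-increasing = no-inversion⇒increasing α₁ λ x x′ x<x′ inversion →
      avoids (left x , left x′ , right (fromℕ< b≥1) ,
              subst₂ _<_ (sym (left-pos x)) (sym (left-pos x′)) x<x′ ,
              left-before-right x′ _ ,
              subst₂ _<_ (sym (left-val x′)) (sym (left-val x)) (+-monoʳ-< b inversion) ,
              right-below-left x′ _)

    α₂-increasing : Increasing (α₂ ⟨$⟩ʳ_)
    α₂-increasing = no-inversion⇒increasing α₂ λ y y′ y<y′ inversion →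
      avoids (left (fromℕ< a≥1) , right y , right y′ ,
              left-before-right _ y ,
              subst₂ _<_ (sym (right-pos y)) (sym (right-pos y′)) (+-monoʳ-< a y<y′) ,
              right-below-left _ y ,
              subst₂ _<_ (sym (right-val y′)) (sym (right-val y)) inversion)

    acts-as-blockSwap : ActsAsBlockSwap π a b
    acts-as-blockSwap = identityBlocks⇒blockSwap
      (increasing⇒identity α₁ α₁-increasing) (increasing⇒identity α₂ α₂-increasing)

balanced-blockSwap : ∀ {n} (π : Perm n) {a b} → a ≡ b → a ≥ 1 → (e : a + b ≡ n) →
  ActsAsBlockSwap π a b →
  Σ ℕ λ m → m ≥ 1 × Σ (m + m ≡ n) λ e →
    Is21Inflation m m e π (idPerm m) (idPerm m) ×
    ((i : Fin n) → toℕ (π ⟨$⟩ʳ i) ≡ standard21 m (toℕ i))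
balanced-blockSwap π {m} refl m≥1 e swap =
  m , m≥1 , e , is-inflation , (λ i → trans (swap i) (blockSwap-standard21 m (toℕ i)))
  where
  open ≡-Reasoning
  is-inflation : Is21Inflation m m e π (idPerm m) (idPerm m)
  is-inflation i = begin
    toℕ (π ⟨$⟩ʳ cast e i)                 ≡⟨ swap (cast e i) ⟩
    blockSwap m m (toℕ (cast e i))        ≡⟨ cong (blockSwap m m) (toℕ-cast e i) ⟩
    blockSwap m m (toℕ i)                 ≡⟨ sym (inflate21-identityBlocks m m (idPerm m) (idPerm m) (λ _ → refl) (λ _ → refl) i) ⟩
    inflate21 m m (idPerm m) (idPerm m) i ∎

-- π = 21[α₁, α₂] avoids 321, so both blocks are the identity and π is the
-- block swap; being an involution, π maps 0 ↦ b ↦ 0, which forces a = b.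
proposition2p2 : ∀ {n} (π : Perm n) → InI321 π → IsType21 π →
    Σ ℕ λ m → m ≥ 1 × Σ (m + m ≡ n) λ e →
      Is21Inflation m m e π (idPerm m) (idPerm m) ×
      ((i : Fin n) → toℕ (π ⟨$⟩ʳ i) ≡ standard21 m (toℕ i))
proposition2p2 π (involution , avoids) (a , b , e , a≥1 , b≥1 , α₁ , α₂ , π≡21) =
  balanced-blockSwap π a≡b a≥1 e swap
  where
  swap : ActsAsBlockSwap π a b
  swap = Inflation21.Avoiding.acts-as-blockSwap π e π≡21 avoids a≥1 b≥1
  0<n : 0 < _
  0<n = subst (0 <_) e (<-≤-trans a≥1 (m≤m+n a b))
  a≡b : a ≡ b
  a≡b = blockSwap-balanced a≥1 b≥1 (blockSwap-involutive π a b involution swap 0 0<n)
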